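{- For every $n\in\mathbb N$ and $s\in\mathbb R$, $$J^*_s(n)=\sum_{\substack{d\mid n\\ \kappa(d)=\kappa(n)}}J_s(d)\qquad\text{and}\qquad J_s(n)=\sum_{\substack{d\mid n\\ \kappa(d)=\kappa(n)}}J^*_s(d)\,\mu(n/d).$$
   Context: $J_s(n)=\sum_{d\mid n}\mu(d)(n/d)^s$ is the Jordan function of order $s$ ($\mu$ the Möbius function). $d\mid\mid n$ means $d\mid n,\ \gcd(d,n/d)=1$; $\mu^*(n)=(-1)^{\omega(n)}$ with $\omega(n)$ the number of distinct prime factors of $n$; $J^*_s(n)=\sum_{d\mid\mid n}\mu^*(d)(n/d)^s$ is the unitary Jordan function of order $s$. $\kappa(n)=\prod_{p\mid n}p$ is the squarefree kernel. -}

module Defs where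

open import Level using (Level)
open import Data.Nat using (ℕ; zero; suc; _/_; _≟_)
import Data.Nat as ℕ
open import Data.Nat.Divisibility using (_∣?_)
open import Data.Nat.Primality using (prime?)
open import Data.Nat.Coprimality using (coprime?)
open import Data.Bool using (Bool; true; false; not; if_then_else_)
open import Data.List using (List; filter; upTo; length; foldr)
open import Data.Nat.ListAction using (product)
open import Data.List using (all)
open import Relation.Nullary using (does)
open import Relation.Binary.PropositionalEquality using (_≡_)
open import Algebra.Bundles using (CommutativeRing)

-- quotient n / d, with the (irrelevant) convention n / 0 = 0
quot : ℕ → ℕ → ℕ
quot n zero    = 0
quot n (suc k) = n / suc k

divisors : ℕ → List ℕ
divisors n = filter (λ d → d ∣? n) (upTo (suc n))

unitaryDivisors : ℕ → List ℕ
unitaryDivisors n = filter (λ d → coprime? d (quot n d)) (divisors n)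

primeFactors : ℕ → List ℕ
primeFactors n = filter prime? (divisors n)

ω : ℕ → ℕ
ω n = length (primeFactors n)

κ : ℕ → ℕ
κ n = product (primeFactors n)

squarefree : ℕ → Bool
squarefree n = all (λ p → not (does ((p ℕ.* p) ∣? n))) (primeFactors n)

-- Arithmetic functions with values in a commutative ring R, where
-- pw : ℕ → R plays the role of x ↦ x^s (a multiplicative power map).
module Jordan {c ℓ : Level} (R : CommutativeRing c ℓ) (pw : ℕ → CommutativeRing.Carrier R) where
  open CommutativeRing R

  sgn : ℕ → Carrier
  sgn zero    = 1#
  sgn (suc k) = - (sgn k)

  μ : ℕ → Carrier
  μ n = if squarefree n then sgn (ω n) else 0#

  μ* : ℕ → Carrier
  μ* n = sgn (ω n)

  Σ : List ℕ → (ℕ → Carrier) → Carrier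
  Σ xs g = foldr (λ x acc → g x + acc) 0# xs

  J : ℕ → Carrier
  J n = Σ (divisors n) (λ d → μ d * pw (quot n d))

  J* : ℕ → Carrier
  J* n = Σ (unitaryDivisors n) (λ d → μ* d * pw (quot n d))

  sameKernelDivisors : ℕ → List ℕ
  sameKernelDivisors n = filter (λ d → κ d ≟ κ n) (divisors n)

{-# OPTIONS --safe #-}
module Submission where

-- Both identities compare functions that behave multiplicatively along n = pᵃ m with p ∤ m.
-- Every divisor of pᵃ m is p^j y for a unique pair j ≤ a, y ∣ m; unitarity of a divisor and
-- the condition κ(d) = κ(n) split accordingly, so each of the four sums equals a factor
-- depending only on pᵃ times the same sum for m.  With c_k = (p^k)ˢ these factors are
--   J*(pᵃ) = c_a − 1   and   Σ_{1≤j≤a} J(p^j) = Σ_{1≤j≤a} (c_j − c_{j−1}) = c_a − 1,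
--   J(pᵃ) = c_a − c_{a−1}   and   Σ_{1≤j≤a} J*(p^j) μ(p^{a−j}) = J*(pᵃ) − J*(p^{a−1}) = c_a − c_{a−1},
-- so induction on the number of prime factors of n proves both identities.

open import Defs

module Filter where
  open import Data.Bool using (Bool; true; false; _∧_)
  open import Data.Bool.Properties using (∧-assoc; ∧-comm)
  open import Data.List using ([]; _∷_; _++_; [_]; filter; upTo; all)
  open import Data.Nat using (ℕ; suc)
  open import Data.List.Properties using (filter-accept; filter-reject; filter-++; applyUpTo-∷ʳ; ++-identityʳ)
  open import Data.List.Membership.Propositional using (_∈_)
  open import Data.List.Relation.Unary.Any using (here; there)
  import Data.List.Relation.Unary.All as All
  open import Data.List.Relation.Unary.Unique.Propositional using (Unique)
  open import Data.List.Relation.Unary.AllPairs using (_∷_)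
  open import Data.Product using (_×_; _,_; ∃₂)
  open import Data.Empty using (⊥-elim)
  open import Function using (_⇔_; Equivalence; _∘′_)
  open import Level using (Level)
  open import Relation.Nullary using (¬_; does; yes; no; _×-dec_)
  open import Relation.Unary using (Pred; Decidable)
  open import Relation.Binary.PropositionalEquality hiding ([_])

  private variable
    a p q : Level
    A : Set a

  filter-cong-∈ : ∀ {P : Pred A p} {Q : Pred A q} (P? : Decidable P) (Q? : Decidable Q) {xs} →
                  (∀ {x} → x ∈ xs → P x ⇔ Q x) → filter P? xs ≡ filter Q? xs
  filter-cong-∈ P? Q? {[]}     P⇔Q = refl
  filter-cong-∈ P? Q? {x ∷ xs} P⇔Q with P? x | Q? x
  ... | yes _  | yes _  = cong (x ∷_) (filter-cong-∈ P? Q? (λ x∈ → P⇔Q (there x∈)))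
  ... | no  _  | no  _  = filter-cong-∈ P? Q? (λ x∈ → P⇔Q (there x∈))
  ... | yes Px | no ¬Qx = ⊥-elim (¬Qx (Equivalence.to (P⇔Q (here refl)) Px))
  ... | no ¬Px | yes Qx = ⊥-elim (¬Px (Equivalence.from (P⇔Q (here refl)) Qx))

  filter-insert : ∀ {P : Pred A p} {Q : Pred A q} (P? : Decidable P) (Q? : Decidable Q) {x₀ xs} →
                  Unique xs → x₀ ∈ xs → P x₀ → ¬ Q x₀ → (∀ {x} → x ∈ xs → x ≢ x₀ → P x ⇔ Q x) →
                  ∃₂ λ as bs → filter P? xs ≡ as ++ x₀ ∷ bs × filter Q? xs ≡ as ++ bs
  filter-insert P? Q? {xs = x ∷ xs} (x∉xs ∷ _) (here refl) Px₀ ¬Qx₀ P⇔Q =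
    [] , filter Q? xs ,
    trans (filter-accept P? Px₀)
          (cong (x ∷_) (filter-cong-∈ P? Q? λ y∈ → P⇔Q (there y∈) λ y≡x → All.lookup x∉xs y∈ (sym y≡x))) ,
    filter-reject Q? ¬Qx₀
  filter-insert P? Q? {xs = x ∷ xs} (x∉xs ∷ xs-unique) (there x₀∈xs) Px₀ ¬Qx₀ P⇔Q
    with filter-insert P? Q? xs-unique x₀∈xs Px₀ ¬Qx₀ (λ y∈ → P⇔Q (there y∈))
  ... | as , bs , Pxs≡ , Qxs≡ with Q? x | P⇔Q (here refl) (All.lookup x∉xs x₀∈xs)
  ...   | yes Qx | Px⇔Qx = x ∷ as , bs ,
          trans (filter-accept P? (Equivalence.from Px⇔Qx Qx)) (cong (x ∷_) Pxs≡) , cong (x ∷_) Qxs≡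
  ...   | no ¬Qx | Px⇔Qx = as , bs ,
          trans (filter-reject P? (¬Qx ∘′ Equivalence.to Px⇔Qx)) Pxs≡ , Qxs≡

  all-++-∷ : ∀ (f : A → Bool) xs y ys → all f (xs ++ y ∷ ys) ≡ f y ∧ all f (xs ++ ys)
  all-++-∷ f []       y ys = refl
  all-++-∷ f (x ∷ xs) y ys = begin
    f x ∧ all f (xs ++ y ∷ ys)     ≡⟨ cong (f x ∧_) (all-++-∷ f xs y ys) ⟩
    f x ∧ (f y ∧ all f (xs ++ ys)) ≡⟨ sym (∧-assoc (f x) (f y) _) ⟩
    (f x ∧ f y) ∧ all f (xs ++ ys) ≡⟨ cong (_∧ all f (xs ++ ys)) (∧-comm (f x) (f y)) ⟩
    (f y ∧ f x) ∧ all f (xs ++ ys) ≡⟨ ∧-assoc (f y) (f x) _ ⟩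
    f y ∧ (f x ∧ all f (xs ++ ys)) ∎
    where open ≡-Reasoning

  filter-filter : ∀ {P : Pred A p} {Q : Pred A q} (P? : Decidable P) (Q? : Decidable Q) xs →
                  filter P? (filter Q? xs) ≡ filter (λ x → Q? x ×-dec P? x) xs
  filter-filter P? Q? []       = refl
  filter-filter P? Q? (x ∷ xs) with does (Q? x)
  ... | false = filter-filter P? Q? xs
  ... | true with does (P? x)
  ...   | true  = cong (x ∷_) (filter-filter P? Q? xs)
  ...   | false = filter-filter P? Q? xs

  filter-upTo-suc : ∀ {P : Pred ℕ p} (P? : Decidable P) {N} → ¬ P N → filter P? (upTo (suc N)) ≡ filter P? (upTo N)
  filter-upTo-suc P? {N} ¬PN = begin
    filter P? (upTo (suc N))              ≡⟨ cong (filter P?) (sym (applyUpTo-∷ʳ (λ x → x) N)) ⟩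
    filter P? (upTo N ++ [ N ])           ≡⟨ filter-++ P? (upTo N) [ N ] ⟩
    filter P? (upTo N) ++ filter P? [ N ] ≡⟨ cong (filter P? (upTo N) ++_) (filter-reject P? ¬PN) ⟩
    filter P? (upTo N) ++ []              ≡⟨ ++-identityʳ _ ⟩
    filter P? (upTo N)                    ∎
    where open ≡-Reasoning

module Arithmetic where
  open import Data.Bool using (Bool; _∧_; not)
  open import Data.Empty using (⊥; ⊥-elim)
  open import Data.List using ([]; _∷_; _++_; filter; upTo; length; all)
  open import Data.Nat.ListAction using (product)
  open import Data.List.Relation.Unary.All using (_∷_)
  open import Data.Product using (_×_; _,_; proj₁; proj₂; ∃-syntax; ∃₂)
  import Data.Sum
  open import Data.Sum using (_⊎_; inj₁; inj₂; [_,_]′; reduce)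
  open import Function using (_∘_; _⇔_; mk⇔)
  open import Relation.Nullary using (¬_; Dec; yes; no; does; _×-dec_)
  open import Relation.Nullary.Decidable using (does-⇔; dec-true; dec-false)
  open import Relation.Binary.PropositionalEquality hiding ([_])
  open Filter

  open import Data.Nat
  open import Data.Nat.Properties
  open import Data.Nat.Divisibility
  open import Data.Nat.DivMod using (m*n/n≡m; m*[n/m]≡n)
  open import Data.Nat.Induction using (<-rec)
  open import Data.Nat.Primality
  open import Data.List.Membership.Propositional using (_∈_)
  open import Data.List.Membership.Propositional.Properties using (∈-upTo⁺; ∈-filter⁻)
  open import Data.List.Relation.Unary.Unique.Propositional.Properties using (upTo⁺)
  open import Data.List.Properties using (length-++-sucʳ; map-cong-local)
  import Data.List.Relation.Unary.All as All
  open import Data.Nat.ListAction.Properties using (product-↭)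
  open import Data.List.Relation.Binary.Permutation.Propositional.Properties using (shift)
  open import Data.Nat.Primality.Factorisation using (factorise; factorisationHasAllPrimeFactors)
  open import Data.Nat.Coprimality using (Coprime; coprime-divisor)
  open import Algebra.Properties.CommutativeSemigroup *-commutativeSemigroup using (interchange)

  prime∣prime⇒≡ : ∀ {r p} → Prime r → Prime p → r ∣ p → r ≡ p
  prime∣prime⇒≡ pr pp r∣p with prime⇒irreducible pp r∣p
  ... | inj₁ refl = ⊥-elim (¬prime[1] pr)
  ... | inj₂ r≡p  = r≡p

  prime∣^⇒≡ : ∀ {r p} i → Prime r → Prime p → r ∣ p ^ i → r ≡ p
  prime∣^⇒≡ zero    pr pp r∣1 = ⊥-elim (¬prime[1] (subst Prime (∣1⇒≡1 r∣1) pr))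
  prime∣^⇒≡ {p = p} (suc i) pr pp r∣p^ with euclidsLemma p (p ^ i) pr r∣p^
  ... | inj₁ r∣p  = prime∣prime⇒≡ pr pp r∣p
  ... | inj₂ r∣p^ = prime∣^⇒≡ i pr pp r∣p^

  prime∣^*⇒ : ∀ {r p e} i → Prime r → Prime p → r ∣ p ^ i * e → r ≡ p ⊎ r ∣ e
  prime∣^*⇒ {p = p} {e} i pr pp r∣ with euclidsLemma (p ^ i) e pr r∣
  ... | inj₁ r∣p^ = inj₁ (prime∣^⇒≡ i pr pp r∣p^)
  ... | inj₂ r∣e  = inj₂ r∣e

  prime-divisor : ∀ n → .{{NonTrivial n}} → ∃[ r ] Prime r × r ∣ n
  prime-divisor n@(suc (suc _)) with factorise n
  ... | record { factors = [] ; isFactorisation = () }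
  ... | record { factors = r ∷ rs ; isFactorisation = n≡ ; factorsPrime = pr ∷ _ } =
    r , pr , subst (r ∣_) (sym n≡) (m∣m*n (product rs))

  coprime⇒¬common-prime : ∀ {x y r} → Coprime x y → Prime r → r ∣ x → r ∣ y → ⊥
  coprime⇒¬common-prime c pr r∣x r∣y = ¬prime[1] (subst Prime (c (r∣x , r∣y)) pr)

  ¬common-prime⇒coprime : ∀ {x y} → (∀ {r} → Prime r → r ∣ x → r ∣ y → ⊥) → Coprime x y
  ¬common-prime⇒coprime h {zero} (0∣x , 0∣y) =
    ⊥-elim (h prime[2] (subst (2 ∣_) (sym (0∣⇒≡0 0∣x)) (2 ∣0)) (subst (2 ∣_) (sym (0∣⇒≡0 0∣y)) (2 ∣0)))
  ¬common-prime⇒coprime h {1} _ = refl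
  ¬common-prime⇒coprime h {d@(suc (suc _))} (d∣x , d∣y) with prime-divisor d
  ... | r , pr , r∣d = ⊥-elim (h pr (∣-trans r∣d d∣x) (∣-trans r∣d d∣y))

  quot≡/ : ∀ n x .{{_ : NonZero x}} → quot n x ≡ n / x
  quot≡/ n (suc x) = refl

  quot-*ˡ : ∀ x k .{{_ : NonZero x}} → quot (x * k) x ≡ k
  quot-*ˡ x k = trans (quot≡/ (x * k) x) (trans (cong (_/ x) (*-comm x k)) (m*n/n≡m k x))

  *-quot : ∀ {y m} → .{{NonZero y}} → y ∣ m → y * quot m y ≡ m
  *-quot {y} {m} y∣m = trans (cong (y *_) (quot≡/ m y)) (m*[n/m]≡n y∣m)

  nonZero-∣ : ∀ {y m} .{{_ : NonZero m}} → y ∣ m → NonZero y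
  nonZero-∣ {zero} {m} 0∣m = ⊥-elim (≢-nonZero⁻¹ m (0∣⇒≡0 0∣m))
  nonZero-∣ {suc y} _ = _

  quot-∣ : ∀ {y m} .{{_ : NonZero m}} → y ∣ m → quot m y ∣ m
  quot-∣ {zero}  {m} 0∣m = ⊥-elim (≢-nonZero⁻¹ m (0∣⇒≡0 0∣m))
  quot-∣ {suc y} {m} y∣m = m/n∣m y∣m

  quot-nonZero : ∀ {y m} .{{_ : NonZero m}} → y ∣ m → NonZero (quot m y)
  quot-nonZero y∣m = nonZero-∣ (quot-∣ y∣m)

  nonZero-∤ : ∀ {p m} → ¬ p ∣ m → NonZero m
  nonZero-∤ {p} {zero}  p∤0 = ⊥-elim (p∤0 (p ∣0))
  nonZero-∤ {p} {suc m} _   = _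

  ∤-divisor : ∀ {p m y} → ¬ p ∣ m → y ∣ m → ¬ p ∣ y
  ∤-divisor p∤m y∣m p∣y = p∤m (∣-trans p∣y y∣m)

  ∈-primeFactors⁻ : ∀ {n q} → q ∈ primeFactors n → q ∣ n × Prime q
  ∈-primeFactors⁻ {n} q∈ with ∈-filter⁻ prime? {xs = divisors n} q∈
  ... | q∈divisors , pq = proj₂ (∈-filter⁻ (_∣? n) {xs = upTo (suc n)} q∈divisors) , pq

  isPrimeFactor? : ∀ n x → Dec (x ∣ n × Prime x)
  isPrimeFactor? n x = x ∣? n ×-dec prime? x

  primeFactors-upTo : ∀ n {N} .{{_ : NonZero n}} → n < N → primeFactors n ≡ filter (isPrimeFactor? n) (upTo N)
  primeFactors-upTo n n<N = go (≤⇒≤′ n<N)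
    where
    go : ∀ {N} → suc n ≤′ N → primeFactors n ≡ filter (isPrimeFactor? n) (upTo N)
    go ≤′-refl         = filter-filter prime? (_∣? n) (upTo (suc n))
    go (≤′-step {N} le) = trans (go le) (sym (filter-upTo-suc (isPrimeFactor? n)
                            λ (N∣n , _) → <⇒≱ (≤′⇒≤ le) (∣⇒≤ N∣n)))

  module _ {p : ℕ} (pp : Prime p) where
    private instance
      p≢0 : NonZero p
      p≢0 = prime⇒nonZero pp
      p>1 : NonTrivial p
      p>1 = prime⇒nonTrivial pp

    p∣p^suc* : ∀ i e → p ∣ p ^ suc i * e
    p∣p^suc* i e = ∣m⇒∣m*n e (m∣m*n (p ^ i))

    p∤⇒coprime-p^ : ∀ i {y} → ¬ p ∣ y → Coprime y (p ^ i)
    p∤⇒coprime-p^ i p∤y =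
      ¬common-prime⇒coprime λ pr r∣y r∣p^ → p∤y (subst (_∣ _) (prime∣^⇒≡ i pr pp r∣p^) r∣y)

    p^-split : ∀ {j a} → j ≤ a → p ^ a ≡ p ^ j * p ^ (a ∸ j)
    p^-split {j} {a} j≤a = trans (cong (p ^_) (sym (m+[n∸m]≡n j≤a))) (^-distribˡ-+-* p j (a ∸ j))

    p-adic-split : ∀ x .{{x≢0 : NonZero x}} → ∃₂ λ j y → x ≡ p ^ j * y × ¬ p ∣ y
    p-adic-split x {{x≢0}} = <-rec P step x x≢0
      where
      P : ℕ → Set
      P x = .(NonZero x) → ∃₂ λ j y → x ≡ p ^ j * y × ¬ p ∣ y
      step : ∀ x → (∀ {q} → q < x → P q) → P x
      step x rec x≢0 with p ∣? x
      ... | no p∤x = 0 , x , sym (*-identityˡ x) , p∤x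
      ... | yes p∣x@(divides q x≡q*p) with rec (quotient-< p∣x {{p>1}} {{x≢0}}) (quotient≢0 p∣x {{x≢0}})
      ...   | j , y , q≡p^j*y , p∤y = suc j , y , x≡ , p∤y
        where
        x≡ : x ≡ p * p ^ j * y
        x≡ = trans x≡q*p (trans (*-comm q p) (trans (cong (p *_) q≡p^j*y) (sym (*-assoc p (p ^ j) y))))

    p-adic-split-unique : ∀ j k {y z} → ¬ p ∣ y → ¬ p ∣ z → p ^ j * y ≡ p ^ k * z → j ≡ k × y ≡ z
    p-adic-split-unique zero    zero    {y} {z} _ _ eq = refl , *-cancelˡ-≡ y z 1 eq
    p-adic-split-unique zero    (suc k) p∤y _   eq = ⊥-elim (p∤y (subst (p ∣_) (trans (sym eq) (*-identityˡ _)) (p∣p^suc* k _)))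
    p-adic-split-unique (suc j) zero    _   p∤z eq = ⊥-elim (p∤z (subst (p ∣_) (trans eq (*-identityˡ _)) (p∣p^suc* j _)))
    p-adic-split-unique (suc j) (suc k) {y} {z} p∤y p∤z eq
      with p-adic-split-unique j k p∤y p∤z
             (*-cancelˡ-≡ _ _ p (trans (sym (*-assoc p (p ^ j) y)) (trans eq (*-assoc p (p ^ k) z))))
    ... | refl , y≡z = refl , y≡z

    p^*∣p^* : ∀ {a m j y} → j ≤ a → y ∣ m → p ^ j * y ∣ p ^ a * m
    p^*∣p^* {a} {m} {j} j≤a y∣m = *-pres-∣ (divides (p ^ (a ∸ j)) (trans (p^-split j≤a) (*-comm (p ^ j) (p ^ (a ∸ j))))) y∣m

    ∣p^*⇒ : ∀ a {m x} → ¬ p ∣ m → .{{NonZero x}} → x ∣ p ^ a * m →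
            ∃₂ λ j y → j ≤ a × y ∣ m × x ≡ p ^ j * y
    ∣p^*⇒ a {m} {x} p∤m x∣ with p-adic-split x
    ... | j , y , x≡ , p∤y = j , y , j≤a , y∣m , x≡
      where
      instance
        p^a≢0 : NonZero (p ^ a)
        p^a≢0 = m^n≢0 p a
      p^j∣p^a : p ^ j ∣ p ^ a
      p^j∣p^a = coprime-divisor (Data.Nat.Coprimality.sym (p∤⇒coprime-p^ j p∤m))
                  (subst (p ^ j ∣_) (*-comm (p ^ a) m) (∣-trans (subst (p ^ j ∣_) (sym x≡) (m∣m*n y)) x∣))
      j≤a : j ≤ a
      j≤a = ≮⇒≥ λ a<j → <⇒≱ (^-monoʳ-< p (nonTrivial⇒n>1 p) a<j) (∣⇒≤ p^j∣p^a)
      y∣m : y ∣ m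
      y∣m = coprime-divisor (p∤⇒coprime-p^ a p∤y) (∣-trans (subst (y ∣_) (trans (*-comm y (p ^ j)) (sym x≡)) (m∣m*n (p ^ j))) x∣)

    primeFactors-p^suc* : ∀ i {e} → ¬ p ∣ e →
      ∃₂ λ as bs → primeFactors (p ^ suc i * e) ≡ as ++ p ∷ bs × primeFactors e ≡ as ++ bs
    primeFactors-p^suc* i {e} p∤e =
      let as , bs , PFn , PFe = filter-insert (isPrimeFactor? n) (isPrimeFactor? e) (upTo⁺ (suc n))
                                  (∈-upTo⁺ (s≤s (∣⇒≤ p∣n))) (p∣n , pp) (p∤e ∘ proj₁) same
      in as , bs , trans (primeFactors-upTo n ≤-refl) PFn , trans (primeFactors-upTo e (s≤s (∣⇒≤ e∣n))) PFe
      where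
      n = p ^ suc i * e
      instance
        e≢0 : NonZero e
        e≢0 = nonZero-∤ p∤e
        n≢0 : NonZero n
        n≢0 = m*n≢0 (p ^ suc i) e {{m^n≢0 p (suc i)}}
      p∣n : p ∣ n
      p∣n = p∣p^suc* i e
      e∣n : e ∣ n
      e∣n = n∣m*n (p ^ suc i)
      same : ∀ {x} → x ∈ upTo (suc n) → x ≢ p → (x ∣ n × Prime x) ⇔ (x ∣ e × Prime x)
      same _ x≢p = mk⇔ (λ (x∣n , px) → [ (λ x≡p → ⊥-elim (x≢p x≡p)) , (_, px) ]′ (prime∣^*⇒ (suc i) px pp x∣n))
                       (λ (x∣e , px) → ∣n⇒∣m*n (p ^ suc i) x∣e , px)

    ω-p^suc* : ∀ i {e} → ¬ p ∣ e → ω (p ^ suc i * e) ≡ suc (ω e)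
    ω-p^suc* i p∤e with primeFactors-p^suc* i p∤e
    ... | as , bs , PFn , PFe = trans (cong length PFn) (trans (length-++-sucʳ as p bs) (cong (suc ∘ length) (sym PFe)))

    κ-p^suc* : ∀ i {e} → ¬ p ∣ e → κ (p ^ suc i * e) ≡ p * κ e
    κ-p^suc* i p∤e with primeFactors-p^suc* i p∤e
    ... | as , bs , PFn , PFe = trans (cong product PFn) (trans (product-↭ (shift p as bs)) (cong ((p *_) ∘ product) (sym PFe)))

    squarefree-p^suc* : ∀ i {e} → ¬ p ∣ e → squarefree (p ^ suc i * e) ≡ does (i ≟ 0) ∧ squarefree e
    squarefree-p^suc* i {e} p∤e with primeFactors-p^suc* i p∤e
    ... | as , bs , PFn , PFe = begin
      all (sqfree-at n) (primeFactors n)      ≡⟨ cong (all (sqfree-at n)) PFn ⟩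
      all (sqfree-at n) (as ++ p ∷ bs)        ≡⟨ all-++-∷ (sqfree-at n) as p bs ⟩
      sqfree-at n p ∧ all (sqfree-at n) (as ++ bs) ≡⟨ cong₂ _∧_ (at-p i) (cong Data.List.and (map-cong-local (All.tabulate at-q))) ⟩
      does (i ≟ 0) ∧ all (sqfree-at e) (as ++ bs) ≡⟨ cong (λ xs → does (i ≟ 0) ∧ all (sqfree-at e) xs) (sym PFe) ⟩
      does (i ≟ 0) ∧ all (sqfree-at e) (primeFactors e) ∎
      where
      open ≡-Reasoning
      n = p ^ suc i * e
      sqfree-at : ℕ → ℕ → Bool
      sqfree-at m q = not (does ((q * q) ∣? m))
      at-p : ∀ k → sqfree-at (p ^ suc k * e) p ≡ does (k ≟ 0)
      at-p zero    = cong not (dec-false ((p * p) ∣? (p ^ 1 * e)) λ pp∣ →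
                       p∤e (*-cancelˡ-∣ p (subst (p * p ∣_) (cong (_* e) (*-identityʳ p)) pp∣)))
      at-p (suc k) = cong not (dec-true ((p * p) ∣? (p ^ suc (suc k) * e))
                       (subst (p * p ∣_) (sym (trans (*-assoc p _ e) (cong (p *_) (*-assoc p (p ^ k) e))))
                          (*-monoʳ-∣ p (m∣m*n (p ^ k * e)))))
      at-q : ∀ {q} → q ∈ as ++ bs → sqfree-at n q ≡ sqfree-at e q
      at-q {q} q∈ with ∈-primeFactors⁻ (subst (q ∈_) (sym PFe) q∈)
      ... | q∣e , pq = cong not (does-⇔ (mk⇔ (coprime-divisor qq⊥p^) (∣n⇒∣m*n (p ^ suc i))) ((q * q) ∣? n) ((q * q) ∣? e))
        where
        qq⊥p^ : Coprime (q * q) (p ^ suc i)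
        qq⊥p^ = ¬common-prime⇒coprime λ pr r∣qq r∣p^ →
          let r≡q = reduce (Data.Sum.map (prime∣prime⇒≡ pr pq) (prime∣prime⇒≡ pr pq) (euclidsLemma q q pr r∣qq))
          in p∤e (subst (_∣ e) (trans (sym r≡q) (prime∣^⇒≡ (suc i) pr pp r∣p^)) q∣e)

    p∤⇒p∤κ : ∀ {e} → ¬ p ∣ e → ¬ p ∣ κ e
    p∤⇒p∤κ {e} p∤e p∣κe =
      p∤e (proj₁ (∈-primeFactors⁻ (factorisationHasAllPrimeFactors pp p∣κe (All.tabulate (proj₂ ∘ ∈-primeFactors⁻ {e})))))

    κ-p^0*≢κ-p^suc* : ∀ i {y m} → ¬ p ∣ y → ¬ p ∣ m → κ (p ^ 0 * y) ≢ κ (p ^ suc i * m)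
    κ-p^0*≢κ-p^suc* i {y} {m} p∤y p∤m eq = p∤⇒p∤κ p∤y (divides (κ m) (begin
      κ y               ≡⟨ cong κ (*-identityˡ y) ⟨
      κ (1 * y)         ≡⟨ eq ⟩
      κ (p ^ suc i * m) ≡⟨ κ-p^suc* i p∤m ⟩
      p * κ m           ≡⟨ *-comm p (κ m) ⟩
      κ m * p           ∎))
      where open ≡-Reasoning

    κ-p^suc*≡κ-p^suc*⇔ : ∀ i j {y m} → ¬ p ∣ y → ¬ p ∣ m → κ (p ^ suc j * y) ≡ κ (p ^ suc i * m) ⇔ κ y ≡ κ m
    κ-p^suc*≡κ-p^suc*⇔ i j p∤y p∤m = mk⇔
      (λ eq → *-cancelˡ-≡ _ _ p (trans (sym (κ-p^suc* j p∤y)) (trans eq (κ-p^suc* i p∤m))))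
      (λ eq → trans (κ-p^suc* j p∤y) (trans (cong (p *_) eq) (sym (κ-p^suc* i p∤m))))

    quot-p^* : ∀ {a m j y} .{{_ : NonZero m}} → j ≤ a → y ∣ m → quot (p ^ a * m) (p ^ j * y) ≡ p ^ (a ∸ j) * quot m y
    quot-p^* {a} {m} {j} {y} j≤a y∣m = begin
      quot (p ^ a * m) (p ^ j * y)                                  ≡⟨ cong (λ n → quot n (p ^ j * y)) p^a*m≡ ⟩
      quot (p ^ j * y * (p ^ (a ∸ j) * quot m y)) (p ^ j * y)       ≡⟨ quot-*ˡ (p ^ j * y) _ ⟩
      p ^ (a ∸ j) * quot m y                                        ∎
      where
      open ≡-Reasoning
      instance
        y≢0 : NonZero y
        y≢0 = nonZero-∣ y∣m
        p^j*y≢0 : NonZero (p ^ j * y)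
        p^j*y≢0 = m*n≢0 (p ^ j) y {{m^n≢0 p j}}
      p^a*m≡ : p ^ a * m ≡ p ^ j * y * (p ^ (a ∸ j) * quot m y)
      p^a*m≡ = trans (cong₂ _*_ (p^-split j≤a) (sym (*-quot y∣m))) (interchange (p ^ j) (p ^ (a ∸ j)) y (quot m y))

    coprime-p^*⇔ : ∀ j k {y f} → ¬ p ∣ y → ¬ p ∣ f →
                   Coprime (p ^ j * y) (p ^ k * f) ⇔ ((j ≡ 0 ⊎ k ≡ 0) × Coprime y f)
    coprime-p^*⇔ j k {y} {f} p∤y p∤f = mk⇔ to from
      where
      p∤p^0* : ∀ {i z} → i ≡ 0 → ¬ p ∣ z → ¬ p ∣ p ^ i * z
      p∤p^0* refl p∤z p∣ = p∤z (subst (p ∣_) (*-identityˡ _) p∣)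
      to : Coprime (p ^ j * y) (p ^ k * f) → (j ≡ 0 ⊎ k ≡ 0) × Coprime y f
      to c = j≡0∨k≡0 j k c ,
             ¬common-prime⇒coprime (λ pr r∣y r∣f → coprime⇒¬common-prime c pr (∣n⇒∣m*n (p ^ j) r∣y) (∣n⇒∣m*n (p ^ k) r∣f))
        where
        j≡0∨k≡0 : ∀ j k → Coprime (p ^ j * y) (p ^ k * f) → j ≡ 0 ⊎ k ≡ 0
        j≡0∨k≡0 zero    _       _ = inj₁ refl
        j≡0∨k≡0 (suc _) zero    _ = inj₂ refl
        j≡0∨k≡0 (suc j) (suc k) c = ⊥-elim (coprime⇒¬common-prime c pp (p∣p^suc* j y) (p∣p^suc* k f))
      from : (j ≡ 0 ⊎ k ≡ 0) × Coprime y f → Coprime (p ^ j * y) (p ^ k * f)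
      from (j≡0∨k≡0 , y⊥f) = ¬common-prime⇒coprime common
        where
        common : ∀ {r} → Prime r → r ∣ p ^ j * y → r ∣ p ^ k * f → ⊥
        common pr r∣ r∣′ with prime∣^*⇒ j pr pp r∣ | prime∣^*⇒ k pr pp r∣′
        ... | inj₂ r∣y  | inj₂ r∣f  = coprime⇒¬common-prime y⊥f pr r∣y r∣f
        ... | inj₂ r∣y  | inj₁ refl = p∤y r∣y
        ... | inj₁ refl | inj₂ r∣f  = p∤f r∣f
        ... | inj₁ refl | inj₁ _    = [ (λ j≡0 → p∤p^0* j≡0 p∤y r∣) , (λ k≡0 → p∤p^0* k≡0 p∤f r∣′) ]′ j≡0∨k≡0

  induction-on-prime-powers : ∀ {ℓ} (P : ℕ → Set ℓ) → P 1 →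
    (∀ {p} i {m} → Prime p → ¬ p ∣ m → P m → P (p ^ suc i * m)) → ∀ n .{{_ : NonZero n}} → P n
  induction-on-prime-powers {ℓ} P P1 step n {{n≢0}} = <-rec Q go n n≢0
    where
    Q : ℕ → Set ℓ
    Q n = .(NonZero n) → P n
    go : ∀ n → (∀ {m} → m < n → Q m) → Q n
    go 1 _ _ = P1
    go n@(suc (suc _)) rec _ with prime-divisor n
    ... | p , pp , p∣n with p-adic-split pp n
    ...   | zero  , m , n≡ , p∤m = ⊥-elim (p∤m (subst (p ∣_) (trans n≡ (*-identityˡ m)) p∣n))
    ...   | suc i , zero , n≡ , p∤m = ⊥-elim (p∤m (p ∣0))
    ...   | suc i , m@(suc _) , n≡ , p∤m = subst P (sym n≡) (step i pp p∤m (rec m<n _))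
      where
      instance
        p≢0 : NonZero p
        p≢0 = prime⇒nonZero pp
      m<n : m < n
      m<n = subst (m <_) (trans (*-comm m (p ^ suc i)) (sym n≡))
              (m<m*n m (p ^ suc i) (<-≤-trans (nonTrivial⇒n>1 p {{prime⇒nonTrivial pp}}) (m≤m*n p (p ^ i) {{m^n≢0 p i}})))

open Arithmetic

open import Level using (Level)
open import Data.Bool using (Bool; true; false; _∧_; _∨_; if_then_else_)
open import Data.Fin using (toℕ)
open import Data.Fin.Properties using (toℕ<n)
open import Data.List using ([]; _∷_; filter; applyUpTo; upTo)
open import Data.List.Membership.Propositional using (_∈_)
open import Data.List.Membership.Propositional.Properties using (∈-filter⁻)
open import Data.List.Relation.Unary.Any using (here; there)
open import Data.Nat as ℕ using (ℕ; zero; suc; _≟_; _≤_; _<_; _∸_; s≤s; z≤n; NonZero; _^_)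
import Data.Nat.Properties as ℕ
open import Data.Nat.Divisibility using (_∣_; _∣?_; ∣⇒≤)
open import Data.Nat.Primality using (Prime; prime⇒nonZero)
open import Data.Nat.Coprimality using (coprime?)
open import Data.Product using (_×_; _,_; proj₁; proj₂)
open import Function using (_∘_; id)
open import Relation.Nullary using (¬_; Dec; yes; no; does; _×-dec_; _⊎-dec_)
open import Relation.Nullary.Decidable using (dec-true; dec-false; does-⇔)
open import Relation.Unary using (Pred; Decidable)
open import Relation.Binary.PropositionalEquality as ≡ using (_≡_; _≢_)
open import Algebra.Bundles using (CommutativeRing)

module _ {c ℓ : Level} (R : CommutativeRing c ℓ) (pw : ℕ → CommutativeRing.Carrier R) where
  open CommutativeRing R
  open import Algebra.Properties.Semiring.Sum semiring using (sum; sum-cong-≋; ∑-comm; *-distribʳ-sum; sum-replicate-zero)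
  open import Relation.Binary.Reasoning.Setoid setoid
  open Jordan R pw
  open import Algebra.Properties.Ring ring using (-1*x≈-x)
  open import Algebra.Properties.AbelianGroup +-abelianGroup using (⁻¹-anti-homo‿-)
  open import Algebra.Properties.CommutativeSemigroup *-commutativeSemigroup using (interchange)

  ∑< : ℕ → (ℕ → Carrier) → Carrier
  ∑< N f = sum {N} (f ∘ toℕ)

  guard : Bool → Carrier → Carrier
  guard true  v = v
  guard false _ = 0#

  guard-yes : ∀ {q} {Q : Set q} (Q? : Dec Q) {v} → Q → guard (does Q?) v ≈ v
  guard-yes Q? {v} q = reflexive (≡.cong (λ b → guard b v) (dec-true Q? q))

  guard-no : ∀ {q} {Q : Set q} (Q? : Dec Q) {v} → ¬ Q → guard (does Q?) v ≈ 0#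
  guard-no Q? {v} ¬q = reflexive (≡.cong (λ b → guard b v) (dec-false Q? ¬q))

  guard-0# : ∀ b → guard b 0# ≈ 0#
  guard-0# true  = refl
  guard-0# false = refl

  guard-∧ : ∀ b b′ u v → guard (b ∧ b′) (u * v) ≈ guard b u * guard b′ v
  guard-∧ true  true  u v = refl
  guard-∧ true  false u v = sym (zeroʳ u)
  guard-∧ false _     u v = sym (zeroˡ _)

  guard-cong : ∀ b {u v} → u ≈ v → guard b u ≈ guard b v
  guard-cong true  u≈v = u≈v
  guard-cong false _   = refl

  *-guard : ∀ b u v → u * guard b v ≈ guard b (u * v)
  *-guard true  u v = refl
  *-guard false u v = zeroʳ u

  ∑<-cong : ∀ N {f g} → (∀ j → j < N → f j ≈ g j) → ∑< N f ≈ ∑< N g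
  ∑<-cong N f≈g = sum-cong-≋ (λ i → f≈g (toℕ i) (toℕ<n i))

  ∑<-zero : ∀ N {f} → (∀ j → j < N → f j ≈ 0#) → ∑< N f ≈ 0#
  ∑<-zero N f≈0 = trans (∑<-cong N f≈0) (sum-replicate-zero N)

  ∑<-single : ∀ N {f} k → k < N → (∀ j → j < N → j ≢ k → f j ≈ 0#) → ∑< N f ≈ f k
  ∑<-single (suc N) zero    _         f≈0 =
    trans (+-congˡ (∑<-zero N λ j j< → f≈0 (suc j) (s≤s j<) λ ())) (+-identityʳ _)
  ∑<-single (suc N) (suc k) (s≤s k<N) f≈0 =
    trans (+-congʳ (f≈0 0 (s≤s z≤n) λ ()))
      (trans (+-identityˡ _) (∑<-single N k k<N λ j j< j≢k → f≈0 (suc j) (s≤s j<) (j≢k ∘ ℕ.suc-injective)))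

  ∑<-comm : ∀ N M (f : ℕ → ℕ → Carrier) → ∑< N (λ i → ∑< M (f i)) ≈ ∑< M (λ j → ∑< N (λ i → f i j))
  ∑<-comm N M f = ∑-comm {N} {M} (λ i j → f (toℕ i) (toℕ j))

  ∑<-*ʳ : ∀ N f x → ∑< N f * x ≈ ∑< N (λ j → f j * x)
  ∑<-*ʳ N f x = *-distribʳ-sum {N} x (f ∘ toℕ)

  ∑<-delta : ∀ N {v} (g : ℕ → Carrier) → v < N → ∑< N (λ x → guard (does (x ≟ v)) (g x)) ≈ g v
  ∑<-delta N {v} g v<N = trans (∑<-single N v v<N λ j _ j≢v → guard-no (j ≟ v) j≢v) (guard-yes (v ≟ v) ≡.refl)

  Σ-applyUpTo : ∀ (g : ℕ → ℕ) N f → Σ (applyUpTo g N) f ≡ ∑< N (f ∘ g)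
  Σ-applyUpTo g zero    f = ≡.refl
  Σ-applyUpTo g (suc N) f = ≡.cong (f (g 0) +_) (Σ-applyUpTo (g ∘ suc) N f)

  Σ-filter : ∀ {p} {P : Pred ℕ p} (P? : Decidable P) xs f → Σ (filter P? xs) f ≈ Σ xs (λ x → guard (does (P? x)) (f x))
  Σ-filter P? []       f = refl
  Σ-filter P? (x ∷ xs) f with does (P? x)
  ... | true  = +-congˡ (Σ-filter P? xs f)
  ... | false = trans (Σ-filter P? xs f) (sym (+-identityˡ _))

  Σ-divisors : ∀ n f → Σ (divisors n) f ≈ ∑< (suc n) (λ x → guard (does (x ∣? n)) (f x))
  Σ-divisors n f = trans (Σ-filter (_∣? n) (upTo (suc n)) f) (reflexive (Σ-applyUpTo id (suc n) _))

  Σ-cong-∈ : ∀ xs {f g} → (∀ {x} → x ∈ xs → f x ≈ g x) → Σ xs f ≈ Σ xs g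
  Σ-cong-∈ []       f≈g = refl
  Σ-cong-∈ (x ∷ xs) f≈g = +-cong (f≈g (here ≡.refl)) (Σ-cong-∈ xs (f≈g ∘ there))

  *-Σ : ∀ xs u f → u * Σ xs f ≈ Σ xs (λ x → u * f x)
  *-Σ []       u f = zeroʳ u
  *-Σ (x ∷ xs) u f = trans (distribˡ u _ _) (+-congˡ (*-Σ xs u f))

  module _ {p} (pp : Prime p) (a : ℕ) {m} (p∤m : ¬ p ∣ m) where
    private
      n = p ^ a ℕ.* m
      instance
        p≢0 : NonZero p
        p≢0 = prime⇒nonZero pp
        m≢0 : NonZero m
        m≢0 = nonZero-∤ p∤m
        n≢0 : NonZero n
        n≢0 = ℕ.m*n≢0 (p ^ a) m {{ℕ.m^n≢0 p a}}

    divisor-indicator : ∀ x v → guard (does (x ∣? n)) v ≈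
      ∑< (suc a) (λ j → ∑< (suc m) (λ y → guard (does (x ≟ p ^ j ℕ.* y)) (guard (does (y ∣? m)) v)))
    divisor-indicator x v with x ∣? n
    ... | no x∤n = sym (∑<-zero (suc a) λ j j< → ∑<-zero (suc m) λ y _ → miss j (ℕ.≤-pred j<) y)
      where
      miss : ∀ j → j ≤ a → ∀ y → guard (does (x ≟ p ^ j ℕ.* y)) (guard (does (y ∣? m)) v) ≈ 0#
      miss j j≤a y with y ∣? m
      ... | no _    = guard-0# (does (x ≟ p ^ j ℕ.* y))
      ... | yes y∣m = guard-no (x ≟ p ^ j ℕ.* y) λ { ≡.refl → x∤n (p^*∣p^* pp j≤a y∣m) }
    ... | yes x∣n with ∣p^*⇒ pp a p∤m {{nonZero-∣ x∣n}} x∣n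
    ...   | j₀ , y₀ , j₀≤a , y₀∣m , ≡.refl =
      sym (trans (∑<-single (suc a) j₀ (s≤s j₀≤a) λ j _ j≢j₀ → ∑<-zero (suc m) λ y _ → miss j y (j≢j₀ ∘ proj₁))
          (trans (∑<-single (suc m) y₀ (s≤s (∣⇒≤ y₀∣m)) λ y _ y≢y₀ → miss j₀ y (y≢y₀ ∘ proj₂))
                 (trans (guard-yes (p ^ j₀ ℕ.* y₀ ≟ p ^ j₀ ℕ.* y₀) ≡.refl) (guard-yes (y₀ ∣? m) y₀∣m))))
      where
      miss : ∀ j y → ¬ (j ≡ j₀ × y ≡ y₀) → guard (does (p ^ j₀ ℕ.* y₀ ≟ p ^ j ℕ.* y)) (guard (does (y ∣? m)) v) ≈ 0#
      miss j y ¬hit with y ∣? m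
      ... | no _    = guard-0# (does (p ^ j₀ ℕ.* y₀ ≟ p ^ j ℕ.* y))
      ... | yes y∣m = guard-no (p ^ j₀ ℕ.* y₀ ≟ p ^ j ℕ.* y) λ eq →
        let j₀≡j , y₀≡y = p-adic-split-unique pp j₀ j (∤-divisor p∤m y₀∣m) (∤-divisor p∤m y∣m) eq
        in ¬hit (≡.sym j₀≡j , ≡.sym y₀≡y)

    Σ-divisors-p^* : ∀ h → Σ (divisors n) h ≈ ∑< (suc a) (λ j → Σ (divisors m) (λ y → h (p ^ j ℕ.* y)))
    Σ-divisors-p^* h = begin
      Σ (divisors n) h
        ≈⟨ Σ-divisors n h ⟩
      ∑< (suc n) (λ x → guard (does (x ∣? n)) (h x))
        ≈⟨ ∑<-cong (suc n) (λ x _ → divisor-indicator x (h x)) ⟩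
      ∑< (suc n) (λ x → ∑< (suc a) (λ j → ∑< (suc m) (λ y → F x j y)))
        ≈⟨ ∑<-comm (suc n) (suc a) (λ x j → ∑< (suc m) (F x j)) ⟩
      ∑< (suc a) (λ j → ∑< (suc n) (λ x → ∑< (suc m) (λ y → F x j y)))
        ≈⟨ ∑<-cong (suc a) (λ j _ → ∑<-comm (suc n) (suc m) (λ x → F x j)) ⟩
      ∑< (suc a) (λ j → ∑< (suc m) (λ y → ∑< (suc n) (λ x → F x j y)))
        ≈⟨ ∑<-cong (suc a) (λ j j< → ∑<-cong (suc m) λ y y< →
             ∑<-delta (suc n) (λ x → guard (does (y ∣? m)) (h x)) (s≤s (p^j*y≤n (ℕ.≤-pred j<) (ℕ.≤-pred y<)))) ⟩
      ∑< (suc a) (λ j → ∑< (suc m) (λ y → guard (does (y ∣? m)) (h (p ^ j ℕ.* y))))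
        ≈⟨ ∑<-cong (suc a) (λ j _ → sym (Σ-divisors m (h ∘ (p ^ j ℕ.*_)))) ⟩
      ∑< (suc a) (λ j → Σ (divisors m) (λ y → h (p ^ j ℕ.* y)))
        ∎
      where
      F : ℕ → ℕ → ℕ → Carrier
      F x j y = guard (does (x ≟ p ^ j ℕ.* y)) (guard (does (y ∣? m)) (h x))
      p^j*y≤n : ∀ {j y} → j ≤ a → y ≤ m → p ^ j ℕ.* y ≤ n
      p^j*y≤n j≤a y≤m = ℕ.*-mono-≤ (ℕ.^-monoʳ-≤ p j≤a) y≤m

    Σ-divisors-p^*-factor : ∀ h g α → (∀ j → j ≤ a → ∀ y → y ∣ m → h (p ^ j ℕ.* y) ≈ α j * g y) →
                            Σ (divisors n) h ≈ ∑< (suc a) α * Σ (divisors m) g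
    Σ-divisors-p^*-factor h g α h≈α*g = begin
      Σ (divisors n) h                                           ≈⟨ Σ-divisors-p^* h ⟩
      ∑< (suc a) (λ j → Σ (divisors m) (λ y → h (p ^ j ℕ.* y))) ≈⟨ ∑<-cong (suc a) factor ⟩
      ∑< (suc a) (λ j → α j * Σ (divisors m) g)                  ≈⟨ ∑<-*ʳ (suc a) α _ ⟨
      ∑< (suc a) α * Σ (divisors m) g                            ∎
      where
      divisor : ∀ {y} → y ∈ divisors m → y ∣ m
      divisor y∈ = proj₂ (∈-filter⁻ (_∣? m) {xs = upTo (suc m)} y∈)
      factor : ∀ j → j < suc a → Σ (divisors m) (λ y → h (p ^ j ℕ.* y)) ≈ α j * Σ (divisors m) g
      factor j j< = trans (Σ-cong-∈ (divisors m) λ y∈ → h≈α*g j (ℕ.≤-pred j<) _ (divisor y∈))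
                          (sym (*-Σ (divisors m) (α j) g))

  μ-ppow : ℕ → Carrier
  μ-ppow 0             = 1#
  μ-ppow 1             = - 1#
  μ-ppow (suc (suc _)) = 0#

  μ*-ppow : ℕ → Carrier
  μ*-ppow 0       = 1#
  μ*-ppow (suc _) = - 1#

  Δ : (ℕ → Carrier) → ℕ → Carrier
  Δ f 0       = f 0
  Δ f (suc k) = f (suc k) - f k

  x-y+z-x≈z-y : ∀ x y z → (x - y) + (z - x) ≈ z - y
  x-y+z-x≈z-y x y z = begin
    (x - y) + (z - x)   ≈⟨ +-comm _ _ ⟩
    (z - x) + (x - y)   ≈⟨ +-assoc _ _ _ ⟩
    z + (- x + (x - y)) ≈⟨ +-congˡ (+-assoc _ _ _) ⟨
    z + ((- x + x) - y) ≈⟨ +-congˡ (+-congʳ (-‿inverseˡ x)) ⟩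
    z + (0# - y)        ≈⟨ +-congˡ (+-identityˡ _) ⟩
    z - y               ∎

  x-z-[y-z]≈x-y : ∀ x y z → (x - z) - (y - z) ≈ x - y
  x-z-[y-z]≈x-y x y z = begin
    (x - z) - (y - z) ≈⟨ +-congˡ (⁻¹-anti-homo‿- y z) ⟩
    (x - z) + (z - y) ≈⟨ +-comm _ _ ⟩
    (z - y) + (x - z) ≈⟨ x-y+z-x≈z-y z y x ⟩
    x - y             ∎

  ∑<-Δ : ∀ k f → ∑< k (λ j → Δ f (suc j)) ≈ f k - f 0
  ∑<-Δ zero    f = sym (-‿inverseʳ (f 0))
  ∑<-Δ (suc k) f = trans (+-congˡ (∑<-Δ k (f ∘ suc))) (x-y+z-x≈z-y (f 1) (f 0) (f (suc k)))

  ∑<-μ-ppow* : ∀ f i → ∑< (suc i) (λ j → μ-ppow j * f (i ∸ j)) ≈ Δ f i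
  ∑<-μ-ppow* f zero    = trans (+-identityʳ _) (*-identityˡ (f 0))
  ∑<-μ-ppow* f (suc k) = begin
    1# * f (suc k) + (- 1# * f k + ∑< k (λ j → 0# * f (k ∸ suc j)))
      ≈⟨ +-cong (*-identityˡ _) (+-cong (-1*x≈-x (f k)) (∑<-zero k λ j _ → zeroˡ (f (k ∸ suc j)))) ⟩
    f (suc k) + (- f k + 0#) ≈⟨ +-congˡ (+-identityʳ _) ⟩
    f (suc k) - f k          ∎

  ∑<-*μ-ppow : ∀ f i → ∑< (suc i) (λ j → f j * μ-ppow (i ∸ j)) ≈ Δ f i
  ∑<-*μ-ppow f zero          = trans (+-identityʳ _) (*-identityʳ (f 0))
  ∑<-*μ-ppow f (suc zero)    = begin
    f 0 * - 1# + (f 1 * 1# + 0#) ≈⟨ +-cong (trans (*-comm _ _) (-1*x≈-x (f 0))) (trans (+-identityʳ _) (*-identityʳ (f 1))) ⟩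
    - f 0 + f 1                  ≈⟨ +-comm _ _ ⟩
    f 1 - f 0                    ∎
  ∑<-*μ-ppow f (suc (suc k)) = trans (+-congʳ (zeroʳ (f 0))) (trans (+-identityˡ _) (∑<-*μ-ppow (f ∘ suc) (suc k)))

  kernelSumJ kernelSumJ*μ : ℕ → Carrier
  kernelSumJ   n = Σ (sameKernelDivisors n) J
  kernelSumJ*μ n = Σ (sameKernelDivisors n) (λ d → J* d * μ (quot n d))

  Corollary2 : ℕ → Set ℓ
  Corollary2 n = (J* n ≈ kernelSumJ n) × (J n ≈ kernelSumJ*μ n)

  corollary2-1 : Corollary2 1
  corollary2-1 = sym (+-identityʳ _) , sym (trans (+-identityʳ _) (*-identityʳ _))

  module _ (pw-1 : pw 1 ≈ 1#) (pw-* : ∀ a b → pw (suc a ℕ.* suc b) ≈ pw (suc a) * pw (suc b)) where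

    pw-*′ : ∀ x y .{{_ : NonZero x}} .{{_ : NonZero y}} → pw (x ℕ.* y) ≈ pw x * pw y
    pw-*′ (suc x) (suc y) = pw-* x y

    module _ {p} (pp : Prime p) where
      private instance
        p≢0 : NonZero p
        p≢0 = prime⇒nonZero pp

      pw-p^ : ℕ → Carrier
      pw-p^ k = pw (p ^ k)

      μ-p^* : ∀ j {y} → ¬ p ∣ y → μ (p ^ j ℕ.* y) ≈ μ-ppow j * μ y
      μ-p^* zero    {y} _   = trans (reflexive (≡.cong μ (ℕ.*-identityˡ y))) (sym (*-identityˡ (μ y)))
      μ-p^* (suc i) {y} p∤y = begin
        μ (p ^ suc i ℕ.* y)
          ≡⟨ ≡.cong₂ (λ b w → if b then sgn w else 0#) (squarefree-p^suc* pp i p∤y) (ω-p^suc* pp i p∤y) ⟩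
        (if does (i ≟ 0) ∧ squarefree y then - sgn (ω y) else 0#) ≈⟨ local i ⟩
        μ-ppow (suc i) * μ y ∎
        where
        local : ∀ i → (if does (i ≟ 0) ∧ squarefree y then - sgn (ω y) else 0#) ≈ μ-ppow (suc i) * μ y
        local zero with squarefree y
        ... | true  = sym (-1*x≈-x _)
        ... | false = sym (zeroʳ _)
        local (suc _) = sym (zeroˡ _)

      μ*-p^* : ∀ j {y} → ¬ p ∣ y → μ* (p ^ j ℕ.* y) ≈ μ*-ppow j * μ* y
      μ*-p^* zero    {y} _   = trans (reflexive (≡.cong μ* (ℕ.*-identityˡ y))) (sym (*-identityˡ (μ* y)))
      μ*-p^* (suc i) {y} p∤y = trans (reflexive (≡.cong sgn (ω-p^suc* pp i p∤y))) (sym (-1*x≈-x _))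

      module _ {m} (p∤m : ¬ p ∣ m) where
        private instance
          m≢0 : NonZero m
          m≢0 = nonZero-∤ p∤m

        pw-p^*quot : ∀ k {y} → y ∣ m → pw (p ^ k ℕ.* quot m y) ≈ pw-p^ k * pw (quot m y)
        pw-p^*quot k y∣m = pw-*′ (p ^ k) _ {{ℕ.m^n≢0 p k}} {{quot-nonZero y∣m}}

        J-p^* : ∀ a → J (p ^ a ℕ.* m) ≈ Δ pw-p^ a * J m
        J-p^* a = begin
          J (p ^ a ℕ.* m)                                  ≈⟨ Σ-divisors-p^*-factor pp a p∤m _ _ _ local ⟩
          ∑< (suc a) (λ j → μ-ppow j * pw-p^ (a ∸ j)) * J m ≈⟨ *-congʳ (∑<-μ-ppow* pw-p^ a) ⟩
          Δ pw-p^ a * J m                                  ∎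
          where
          local : ∀ j → j ≤ a → ∀ y → y ∣ m →
            μ (p ^ j ℕ.* y) * pw (quot (p ^ a ℕ.* m) (p ^ j ℕ.* y)) ≈ (μ-ppow j * pw-p^ (a ∸ j)) * (μ y * pw (quot m y))
          local j j≤a y y∣m = begin
            μ (p ^ j ℕ.* y) * pw (quot (p ^ a ℕ.* m) (p ^ j ℕ.* y))  ≡⟨ ≡.cong (λ q → μ (p ^ j ℕ.* y) * pw q) (quot-p^* pp j≤a y∣m) ⟩
            μ (p ^ j ℕ.* y) * pw (p ^ (a ∸ j) ℕ.* quot m y)          ≈⟨ *-cong (μ-p^* j (∤-divisor p∤m y∣m)) (pw-p^*quot (a ∸ j) y∣m) ⟩
            (μ-ppow j * μ y) * (pw-p^ (a ∸ j) * pw (quot m y))       ≈⟨ interchange _ _ _ _ ⟩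
            (μ-ppow j * pw-p^ (a ∸ j)) * (μ y * pw (quot m y))       ∎

        J*-p^suc* : ∀ i → J* (p ^ suc i ℕ.* m) ≈ (pw-p^ (suc i) - 1#) * J* m
        J*-p^suc* i = begin
          J* n                                             ≈⟨ Σ-filter (λ d → coprime? d (quot n d)) (divisors n) _ ⟩
          Σ (divisors n) (unitary n)                       ≈⟨ Σ-divisors-p^*-factor pp a p∤m _ (unitary m) α local ⟩
          ∑< (suc a) α * Σ (divisors m) (unitary m)        ≈⟨ *-cong unitary-coefficient (sym (Σ-filter (λ d → coprime? d (quot m d)) (divisors m) _)) ⟩
          (pw-p^ a - 1#) * J* m                            ∎
          where
          a = suc i
          n = p ^ a ℕ.* m
          unitary : ℕ → ℕ → Carrier
          unitary k d = guard (does (coprime? d (quot k d))) (μ* d * pw (quot k d))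
          α : ℕ → Carrier
          α j = guard (does (j ≟ 0) ∨ does (a ∸ j ≟ 0)) (μ*-ppow j * pw-p^ (a ∸ j))
          local : ∀ j → j ≤ a → ∀ y → y ∣ m → unitary n (p ^ j ℕ.* y) ≈ α j * unitary m y
          local j j≤a y y∣m = begin
            unitary n (p ^ j ℕ.* y)
              ≡⟨ ≡.cong (λ q → guard (does (coprime? (p ^ j ℕ.* y) q)) (μ* (p ^ j ℕ.* y) * pw q)) (quot-p^* pp j≤a y∣m) ⟩
            guard (does (coprime? (p ^ j ℕ.* y) (p ^ (a ∸ j) ℕ.* f))) (μ* (p ^ j ℕ.* y) * pw (p ^ (a ∸ j) ℕ.* f))
              ≡⟨ ≡.cong (λ b → guard b (μ* (p ^ j ℕ.* y) * pw (p ^ (a ∸ j) ℕ.* f))) coprime-split ⟩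
            guard (b₁ ∧ b₂) (μ* (p ^ j ℕ.* y) * pw (p ^ (a ∸ j) ℕ.* f))
              ≈⟨ guard-cong (b₁ ∧ b₂) (trans (*-cong (μ*-p^* j p∤y) (pw-p^*quot (a ∸ j) y∣m)) (interchange _ _ _ _)) ⟩
            guard (b₁ ∧ b₂) ((μ*-ppow j * pw-p^ (a ∸ j)) * (μ* y * pw f))
              ≈⟨ guard-∧ b₁ b₂ _ _ ⟩
            α j * unitary m y ∎
            where
            f = quot m y
            b₁ = does (j ≟ 0) ∨ does (a ∸ j ≟ 0)
            b₂ = does (coprime? y f)
            p∤y = ∤-divisor p∤m y∣m
            p∤f = ∤-divisor p∤m (quot-∣ y∣m)
            coprime-split : does (coprime? (p ^ j ℕ.* y) (p ^ (a ∸ j) ℕ.* f)) ≡ b₁ ∧ b₂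
            coprime-split = does-⇔ (coprime-p^*⇔ pp j (a ∸ j) p∤y p∤f)
              (coprime? (p ^ j ℕ.* y) (p ^ (a ∸ j) ℕ.* f)) ((j ≟ 0 ⊎-dec a ∸ j ≟ 0) ×-dec coprime? y f)
          unitary-coefficient : ∑< (suc a) α ≈ pw-p^ a - 1#
          unitary-coefficient = begin
            1# * pw-p^ a + ∑< a (λ j → guard (does (i ∸ j ≟ 0)) (- 1# * pw-p^ (i ∸ j)))
              ≈⟨ +-cong (*-identityˡ (pw-p^ a)) (∑<-single a i ℕ.≤-refl only-i) ⟩
            pw-p^ a + guard (does (i ∸ i ≟ 0)) (- 1# * pw-p^ (i ∸ i))
              ≈⟨ +-congˡ (trans (guard-yes (i ∸ i ≟ 0) (ℕ.n∸n≡0 i)) (reflexive (≡.cong (λ k → - 1# * pw-p^ k) (ℕ.n∸n≡0 i)))) ⟩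
            pw-p^ a + - 1# * pw 1
              ≈⟨ +-congˡ (trans (-1*x≈-x _) (-‿cong pw-1)) ⟩
            pw-p^ a - 1#
              ∎
            where
            only-i : ∀ j → j < a → j ≢ i → guard (does (i ∸ j ≟ 0)) (- 1# * pw-p^ (i ∸ j)) ≈ 0#
            only-i j j<a j≢i = guard-no (i ∸ j ≟ 0) λ i∸j≡0 → j≢i (ℕ.≤-antisym (ℕ.≤-pred j<a) (ℕ.m∸n≡0⇒m≤n i∸j≡0))

      module _ {m} (p∤m : ¬ p ∣ m) where
        private instance
          m≢0 : NonZero m
          m≢0 = nonZero-∤ p∤m

        sameKernel : ℕ → (ℕ → Carrier) → ℕ → Carrier
        sameKernel k f d = guard (does (κ d ≟ κ k)) (f d)

        sameKernel-p^0* : ∀ i f {y} → y ∣ m → sameKernel (p ^ suc i ℕ.* m) f (p ^ 0 ℕ.* y) ≈ 0#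
        sameKernel-p^0* i f {y} y∣m =
          guard-no (κ (p ^ 0 ℕ.* y) ≟ κ (p ^ suc i ℕ.* m)) (κ-p^0*≢κ-p^suc* pp i (∤-divisor p∤m y∣m) p∤m)

        sameKernel-p^suc* : ∀ i j f {y} → y ∣ m →
          sameKernel (p ^ suc i ℕ.* m) f (p ^ suc j ℕ.* y) ≡ guard (does (κ y ≟ κ m)) (f (p ^ suc j ℕ.* y))
        sameKernel-p^suc* i j f {y} y∣m = ≡.cong (λ b → guard b (f (p ^ suc j ℕ.* y)))
          (does-⇔ (κ-p^suc*≡κ-p^suc*⇔ pp i j (∤-divisor p∤m y∣m) p∤m) (κ (p ^ suc j ℕ.* y) ≟ κ (p ^ suc i ℕ.* m)) (κ y ≟ κ m))

        kernelSumJ-p^suc* : ∀ i → kernelSumJ (p ^ suc i ℕ.* m) ≈ (pw-p^ (suc i) - 1#) * kernelSumJ m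
        kernelSumJ-p^suc* i = begin
          kernelSumJ n                                      ≈⟨ Σ-filter (λ d → κ d ≟ κ n) (divisors n) J ⟩
          Σ (divisors n) (sameKernel n J)                   ≈⟨ Σ-divisors-p^*-factor pp a p∤m _ (sameKernel m J) α local ⟩
          ∑< (suc a) α * Σ (divisors m) (sameKernel m J)    ≈⟨ *-cong coefficient (sym (Σ-filter (λ d → κ d ≟ κ m) (divisors m) J)) ⟩
          (pw-p^ a - 1#) * kernelSumJ m                     ∎
          where
          a = suc i
          n = p ^ a ℕ.* m
          α : ℕ → Carrier
          α zero    = 0#
          α (suc j) = Δ pw-p^ (suc j)
          local : ∀ j → j ≤ a → ∀ y → y ∣ m → sameKernel n J (p ^ j ℕ.* y) ≈ α j * sameKernel m J y
          local zero    _ y y∣m = trans (sameKernel-p^0* i J y∣m) (sym (zeroˡ _))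
          local (suc j) _ y y∣m = begin
            sameKernel n J (p ^ suc j ℕ.* y)               ≡⟨ sameKernel-p^suc* i j J y∣m ⟩
            guard (does (κ y ≟ κ m)) (J (p ^ suc j ℕ.* y)) ≈⟨ guard-cong (does (κ y ≟ κ m)) (J-p^* (∤-divisor p∤m y∣m) (suc j)) ⟩
            guard (does (κ y ≟ κ m)) (α (suc j) * J y)     ≈⟨ *-guard (does (κ y ≟ κ m)) (α (suc j)) (J y) ⟨
            α (suc j) * sameKernel m J y                   ∎
          coefficient : ∑< (suc a) α ≈ pw-p^ a - 1#
          coefficient = trans (+-identityˡ _) (trans (∑<-Δ a pw-p^) (+-congˡ (-‿cong pw-1)))

        kernelSumJ*μ-p^suc* : ∀ i → kernelSumJ*μ (p ^ suc i ℕ.* m) ≈ Δ pw-p^ (suc i) * kernelSumJ*μ m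
        kernelSumJ*μ-p^suc* i = begin
          kernelSumJ*μ n                                    ≈⟨ Σ-filter (λ d → κ d ≟ κ n) (divisors n) (g n) ⟩
          Σ (divisors n) (sameKernel n (g n))               ≈⟨ Σ-divisors-p^*-factor pp a p∤m _ (sameKernel m (g m)) α local ⟩
          ∑< (suc a) α * Σ (divisors m) (sameKernel m (g m)) ≈⟨ *-cong coefficient (sym (Σ-filter (λ d → κ d ≟ κ m) (divisors m) (g m))) ⟩
          Δ pw-p^ a * kernelSumJ*μ m                         ∎
          where
          a = suc i
          n = p ^ a ℕ.* m
          g : ℕ → ℕ → Carrier
          g k d = J* d * μ (quot k d)
          α : ℕ → Carrier
          α zero    = 0#
          α (suc j) = (pw-p^ (suc j) - 1#) * μ-ppow (i ∸ j)
          local : ∀ j → j ≤ a → ∀ y → y ∣ m → sameKernel n (g n) (p ^ j ℕ.* y) ≈ α j * sameKernel m (g m) y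
          local zero    _   y y∣m = trans (sameKernel-p^0* i (g n) y∣m) (sym (zeroˡ _))
          local (suc j) j<a y y∣m = begin
            sameKernel n (g n) (p ^ suc j ℕ.* y)
              ≡⟨ sameKernel-p^suc* i j (g n) y∣m ⟩
            guard (does (κ y ≟ κ m)) (J* (p ^ suc j ℕ.* y) * μ (quot n (p ^ suc j ℕ.* y)))
              ≡⟨ ≡.cong (λ q → guard (does (κ y ≟ κ m)) (J* (p ^ suc j ℕ.* y) * μ q)) (quot-p^* pp j<a y∣m) ⟩
            guard (does (κ y ≟ κ m)) (J* (p ^ suc j ℕ.* y) * μ (p ^ (i ∸ j) ℕ.* quot m y))
              ≈⟨ guard-cong (does (κ y ≟ κ m)) (*-cong (J*-p^suc* (∤-divisor p∤m y∣m) j) (μ-p^* (i ∸ j) (∤-divisor p∤m (quot-∣ y∣m)))) ⟩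
            guard (does (κ y ≟ κ m)) (((pw-p^ (suc j) - 1#) * J* y) * (μ-ppow (i ∸ j) * μ (quot m y)))
              ≈⟨ guard-cong (does (κ y ≟ κ m)) (interchange _ _ _ _) ⟩
            guard (does (κ y ≟ κ m)) (α (suc j) * g m y)   ≈⟨ *-guard (does (κ y ≟ κ m)) (α (suc j)) (g m y) ⟨
            α (suc j) * sameKernel m (g m) y               ∎
          coefficient : ∑< (suc a) α ≈ Δ pw-p^ a
          coefficient = trans (+-identityˡ _) (trans (∑<-*μ-ppow (λ j → pw-p^ (suc j) - 1#) i) (Δ-shift i))
            where
            Δ-shift : ∀ i → Δ (λ j → pw-p^ (suc j) - 1#) i ≈ Δ pw-p^ (suc i)
            Δ-shift zero    = +-congˡ (-‿cong (sym pw-1))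
            Δ-shift (suc k) = x-z-[y-z]≈x-y _ _ _

    corollary2-p^suc* : ∀ {p} i {m} → Prime p → ¬ p ∣ m → Corollary2 m → Corollary2 (p ^ suc i ℕ.* m)
    corollary2-p^suc* i pp p∤m (J*≈ , J≈) =
      trans (J*-p^suc* pp p∤m i) (trans (*-congˡ J*≈) (sym (kernelSumJ-p^suc* pp p∤m i))) ,
      trans (J-p^* pp p∤m (suc i)) (trans (*-congˡ J≈) (sym (kernelSumJ*μ-p^suc* pp p∤m i)))

corollary2 : {c ℓ : Level} (R : CommutativeRing c ℓ) (pw : ℕ → CommutativeRing.Carrier R) →
    CommutativeRing._≈_ R (pw 1) (CommutativeRing.1# R) →
    (∀ a b → CommutativeRing._≈_ R (pw (suc a ℕ.* suc b)) (CommutativeRing._*_ R (pw (suc a)) (pw (suc b)))) →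
    (n : ℕ) →
      CommutativeRing._≈_ R (Jordan.J* R pw (suc n))
        (Jordan.Σ R pw (Jordan.sameKernelDivisors R pw (suc n)) (Jordan.J R pw))
      × CommutativeRing._≈_ R (Jordan.J R pw (suc n))
        (Jordan.Σ R pw (Jordan.sameKernelDivisors R pw (suc n))
          (λ d → CommutativeRing._*_ R (Jordan.J* R pw d) (Jordan.μ R pw (quot (suc n) d))))
corollary2 R pw pw-1 pw-* n =
  induction-on-prime-powers (Corollary2 R pw) (corollary2-1 R pw) (corollary2-p^suc* R pw pw-1 pw-*) (suc n)
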